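{- A nested canalyzing function $f$ of $n$ variables is strongly asymmetric if and only if it is properly $n$-symmetric.
   Context: A Boolean function $f(x_1,\dots,x_n)$ is nested canalyzing if there are a permutation $\pi$ of $\{1,\dots,n\}$ and values $a_1,\dots,a_n,b_1,\dots,b_n\in\{0,1\}$ such that $f(x)=b_i$ for the first $i$ with $x_{\pi(i)}=a_i$, and $f(x)=\overline{b_n}$ if $x_{\pi(i)}\neq a_i$ for all $i$. $f$ is strongly asymmetric if for every permutation $\sigma$ of $\{1,\dots,n\}$ other than the identity there is an input $(c_1,\dots,c_n)\in\{0,1\}^n$ with $f(c_1,\dots,c_n)\neq f(c_{\sigma(1)},\dots,c_{\sigma(n)})$. Two variables are symmetric if interchanging their values never changes the value of $f$; $f$ is $r$-symmetric if its variables can be partitioned into at most $r$ groups such that any two variables in the same group are symmetric; $f$ is properly $r$-symmetric if it is $r$-symmetric but not $(r-1)$-symmetric. -}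

module Defs where

open import Data.Bool using (Bool; true; false; not; if_then_else_; _≟_)
open import Data.Nat using (ℕ; zero; suc; _∸_)
open import Data.Fin using (Fin; zero; suc)
open import Data.Fin.Permutation using (Permutation′; _⟨$⟩ʳ_; transpose)
open import Data.Product using (Σ; ∃; _×_)
open import Relation.Binary.PropositionalEquality using (_≡_; _≢_)
open import Relation.Nullary using (¬_; does)

BoolFn : ℕ → Set
BoolFn n = (Fin n → Bool) → Bool

-- Nested canalyzing cascade on k+1 layers:
-- t i  = "the i-th tested variable takes its canalyzing value a_i",
-- b i  = canalyzed output b_i.
cascade : ∀ {k} → (Fin (suc k) → Bool) → (Fin (suc k) → Bool) → Bool
cascade {zero}  t b = if t zero then b zero else not (b zero)
cascade {suc k} t b = if t zero then b zero else cascade (λ i → t (suc i)) (λ i → b (suc i))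

ncf : ∀ {m} → Permutation′ (suc m) → (Fin (suc m) → Bool) → (Fin (suc m) → Bool)
    → BoolFn (suc m)
ncf π a b x = cascade (λ i → does (x (π ⟨$⟩ʳ i) ≟ a i)) b

NestedCanalyzing : ∀ {m} → BoolFn (suc m) → Set
NestedCanalyzing {m} f =
  Σ (Permutation′ (suc m)) λ π →
  Σ (Fin (suc m) → Bool) λ a →
  Σ (Fin (suc m) → Bool) λ b →
  ∀ x → f x ≡ ncf π a b x

StronglyAsymmetric : ∀ {n} → BoolFn n → Set
StronglyAsymmetric {n} f =
  (σ : Permutation′ n) → ¬ (∀ i → σ ⟨$⟩ʳ i ≡ i) →
  ∃ λ (c : Fin n → Bool) → f c ≢ f (λ i → c (σ ⟨$⟩ʳ i))

SymmetricVars : ∀ {n} → BoolFn n → Fin n → Fin n → Set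
SymmetricVars f i j = ∀ x → f x ≡ f (λ k → x (transpose i j ⟨$⟩ʳ k))

-- r-symmetric: variables partitioned into at most r groups (a labelling by
-- Fin r, empty groups allowed) with any two variables in one group symmetric.
RSymmetric : ∀ {n} → ℕ → BoolFn n → Set
RSymmetric {n} r f =
  Σ (Fin n → Fin r) λ g → ∀ i j → g i ≡ g j → SymmetricVars f i j

ProperlyRSymmetric : ∀ {n} → ℕ → BoolFn n → Set
ProperlyRSymmetric r f = RSymmetric r f × ¬ RSymmetric (r ∸ 1) f

module Submission where

-- Both sides say that f has no two distinct symmetric variables.  For proper
-- n-symmetry this is pigeonhole one way and merging the classes of a symmetric
-- pair the other way; strong asymmetry forbids symmetric pairs because a
-- transposition is not the identity.  The core is the converse: an NCF that is
-- invariant under some σ ≠ id has a symmetric pair.  Conjugating by the variable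
-- order reduces this to the canonical NCF (layer i tests variable i).  If q is
-- the first layer moved by the conjugated permutation τ and r = τ q, probing with
-- inputs that are non-canalyzing before layer q shows that swapping q and r
-- preserves f, possibly after negating the last canalyzing value and output.
-- Invariance under σ is decidable by enumerating inputs, which yields witnesses.

open import Defs
open import Data.Nat using (ℕ; suc)
open import Function.Bundles using (_⇔_; mk⇔)
open import Function.Base using (_∘_; const)
import Data.Nat as ℕ
import Data.Nat.Properties as ℕ
open import Data.Bool using (Bool; true; false; not; if_then_else_)
open import Data.Bool.Properties using (not-involutive; not-¬; ¬-not)
import Data.Bool as Bool
open import Data.Fin using (Fin; Fin′; zero; suc; toℕ; fromℕ; fromℕ<; inject; punchOut; _<_; _≤_)
open import Data.Fin.Properties
  using (_≟_; toℕ-injective; toℕ-fromℕ; toℕ-fromℕ<; toℕ-inject; <⇒≢; ≤∧≢⇒<; <-cmp;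
         ¬∀⟶∃¬-smallest; pigeonhole; punchOut-injective)
open import Data.Fin.Permutation
  using (Permutation′; _⟨$⟩ʳ_; _⟨$⟩ˡ_; inverseˡ; inverseʳ; transpose; _∘ₚ_; flip; lift₀-transpose)
import Data.Fin.Permutation.Components as PC
open import Data.Fin.Subset.Properties using (anySubset?)
open import Data.Vec using (lookup; tabulate)
open import Data.Vec.Properties using (lookup∘tabulate)
open import Data.Vec.Functional using (updateAt)
open import Data.Vec.Functional.Properties using (updateAt-updates; updateAt-minimal)
open import Data.Product using (Σ; ∃; _×_; _,_; proj₁; proj₂)
open import Data.Sum using (_⊎_; inj₁; inj₂)
import Data.Sum as Sum
open import Relation.Nullary using (¬_; Dec; yes; no; does)
open import Relation.Nullary.Decidable using (¬?; dec-true; dec-false; decidable-stable)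
open import Relation.Nullary.Negation using (contradiction)
open import Relation.Binary.Definitions using (tri<; tri≈; tri>)
open import Relation.Binary.PropositionalEquality

permutation-injective : ∀ {n} (σ : Permutation′ n) {i j : Fin n} → σ ⟨$⟩ʳ i ≡ σ ⟨$⟩ʳ j → i ≡ j
permutation-injective σ {i} {j} e = begin
  i                     ≡⟨ inverseˡ σ ⟨
  σ ⟨$⟩ˡ (σ ⟨$⟩ʳ i)     ≡⟨ cong (σ ⟨$⟩ˡ_) e ⟩
  σ ⟨$⟩ˡ (σ ⟨$⟩ʳ j)     ≡⟨ inverseˡ σ ⟩
  j                     ∎
  where open ≡-Reasoning

transpose-at-left : ∀ {n} (i j : Fin n) → PC.transpose i j i ≡ j
transpose-at-left i j rewrite dec-true (i ≟ i) refl = refl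

transpose-at-right : ∀ {n} (i j : Fin n) → PC.transpose i j j ≡ i
transpose-at-right i j with j ≟ i
... | yes j≡i = j≡i
... | no _ rewrite dec-true (j ≟ j) refl = refl

transpose-elsewhere : ∀ {n} (i j k : Fin n) → k ≢ i → k ≢ j → PC.transpose i j k ≡ k
transpose-elsewhere i j k k≢i k≢j rewrite dec-false (k ≟ i) k≢i | dec-false (k ≟ j) k≢j = refl

transpose-invariant : ∀ {n} {A : Set} (h : Fin n → A) {i j : Fin n} → h i ≡ h j
                    → ∀ k → h (PC.transpose i j k) ≡ h k
transpose-invariant h {i} {j} hi≡hj k with k ≟ i
... | yes refl = sym hi≡hj
... | no _ with k ≟ j
...   | yes refl = hi≡hj
...   | no _     = refl

transpose-conjugate : ∀ {n} (π : Permutation′ n) (q r p : Fin n)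
                    → PC.transpose (π ⟨$⟩ʳ q) (π ⟨$⟩ʳ r) (π ⟨$⟩ʳ p) ≡ π ⟨$⟩ʳ PC.transpose q r p
transpose-conjugate π q r p = by-cases (p ≟ q) (p ≟ r)
  where
  Conjugates : Fin _ → Set
  Conjugates k = PC.transpose (π ⟨$⟩ʳ q) (π ⟨$⟩ʳ r) (π ⟨$⟩ʳ k) ≡ π ⟨$⟩ʳ PC.transpose q r k

  by-cases : Dec (p ≡ q) → Dec (p ≡ r) → Conjugates p
  by-cases (yes p≡q) _ = subst Conjugates (sym p≡q)
    (trans (transpose-at-left (π ⟨$⟩ʳ q) (π ⟨$⟩ʳ r)) (cong (π ⟨$⟩ʳ_) (sym (transpose-at-left q r))))
  by-cases (no _) (yes p≡r) = subst Conjugates (sym p≡r)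
    (trans (transpose-at-right (π ⟨$⟩ʳ q) (π ⟨$⟩ʳ r)) (cong (π ⟨$⟩ʳ_) (sym (transpose-at-right q r))))
  by-cases (no p≢q) (no p≢r) =
    trans (transpose-elsewhere _ _ _ (p≢q ∘ permutation-injective π) (p≢r ∘ permutation-injective π))
          (cong (π ⟨$⟩ʳ_) (sym (transpose-elsewhere q r p p≢q p≢r)))

below-or-last : ∀ {m} (p : Fin (suc m)) → toℕ p ℕ.< m ⊎ p ≡ fromℕ m
below-or-last {ℕ.zero} zero    = inj₂ refl
below-or-last {suc m}  zero    = inj₁ ℕ.z<s
below-or-last {suc m}  (suc p) = Sum.map ℕ.s<s (cong suc) (below-or-last p)

below⇒≢last : ∀ {m} {p : Fin (suc m)} → toℕ p ℕ.< m → p ≢ fromℕ m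
below⇒≢last {m} p<m refl = ℕ.<⇒≢ p<m (toℕ-fromℕ m)

cascade-cong : ∀ {k} {t t′ : Fin (suc k) → Bool} (b : Fin (suc k) → Bool)
             → (∀ i → t i ≡ t′ i) → cascade t b ≡ cascade t′ b
cascade-cong {ℕ.zero} b t≗t′ rewrite t≗t′ zero = refl
cascade-cong {suc k} {t′ = t′} b t≗t′ rewrite t≗t′ zero =
  cong (if t′ zero then b zero else_) (cascade-cong (b ∘ suc) (t≗t′ ∘ suc))

cascade-first : ∀ {k} (t b : Fin (suc k) → Bool) {p} → (∀ i → i < p → t i ≡ false) → t p ≡ true
              → cascade t b ≡ b p
cascade-first {ℕ.zero} t b {zero} _ tp rewrite tp = refl
cascade-first {suc k} t b {zero} _ tp rewrite tp = refl
cascade-first {suc k} t b {suc p} earlier tp rewrite earlier zero ℕ.z<s =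
  cascade-first (t ∘ suc) (b ∘ suc) (λ i i<p → earlier (suc i) (ℕ.s<s i<p)) tp

cascade-none : ∀ {k} (t b : Fin (suc k) → Bool) → (∀ i → t i ≡ false) → cascade t b ≡ not (b (fromℕ k))
cascade-none {ℕ.zero} t b fails rewrite fails zero = refl
cascade-none {suc k} t b fails rewrite fails zero = cascade-none (t ∘ suc) (b ∘ suc) (fails ∘ suc)

cascade-constant : ∀ {k} (t b : Fin (suc k) → Bool) {p β} → t p ≡ true → (∀ i → i ≤ p → b i ≡ β)
                 → cascade t b ≡ β
cascade-constant {ℕ.zero} t b {zero} tp b≡β rewrite tp = b≡β zero ℕ.z≤n
cascade-constant {suc k} t b {zero} tp b≡β rewrite tp = b≡β zero ℕ.z≤n
cascade-constant {suc k} t b {suc p} tp b≡β with t zero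
... | true  = b≡β zero ℕ.z≤n
... | false = cascade-constant (t ∘ suc) (b ∘ suc) tp (λ i i≤p → b≡β (suc i) (ℕ.s≤s i≤p))

-- Interchanging two tests q ≤ r does not change a cascade whose outputs are
-- constant on the layers q..r: whichever of the two succeeds first, the
-- cascade stops in that range with the same output.
cascade-transpose : ∀ {k} (t b : Fin (suc k) → Bool) {q r} → q ≤ r
                  → (∀ p → q ≤ p → p ≤ r → b p ≡ b q)
                  → cascade t b ≡ cascade (t ∘ PC.transpose q r) b
cascade-transpose t b {zero} {r} _ b-const with t zero in t0 | t r in tr
... | true  | _     =
  trans (cascade-constant t b t0 (λ i i≤0 → b-const i ℕ.z≤n (ℕ.≤-trans i≤0 ℕ.z≤n)))
        (sym (cascade-constant (t ∘ PC.transpose zero r) b {r}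
               (trans (cong t (transpose-at-right zero r)) t0) (λ i → b-const i ℕ.z≤n)))
... | false | true  =
  trans (cascade-constant t b tr (λ i → b-const i ℕ.z≤n))
        (sym (cascade-constant (t ∘ PC.transpose zero r) b {zero}
               (trans (cong t (transpose-at-left zero r)) tr) (λ i i≤0 → b-const i ℕ.z≤n (ℕ.≤-trans i≤0 ℕ.z≤n))))
... | false | false =
  cascade-cong b (λ i → sym (transpose-invariant t (trans t0 (sym tr)) i))
cascade-transpose {suc k} t b {suc q} {suc r} (ℕ.s≤s q≤r) b-const =
  cong (if t zero then b zero else_)
    (trans (cascade-transpose (t ∘ suc) (b ∘ suc) q≤r (λ p q≤p p≤r → b-const (suc p) (ℕ.s≤s q≤p) (ℕ.s≤s p≤r)))
           (cascade-cong (b ∘ suc) (λ p → cong t (sym (lift₀-transpose q r (suc p))))))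

flipLast : ∀ {k} → (Fin (suc k) → Bool) → Fin (suc k) → Bool
flipLast {ℕ.zero} g i       = not (g i)
flipLast {suc k}  g zero    = g zero
flipLast {suc k}  g (suc i) = flipLast (g ∘ suc) i

flipLast-below : ∀ {k} (g : Fin (suc k) → Bool) {p} → toℕ p ℕ.< k → flipLast g p ≡ g p
flipLast-below {suc k} g {zero}  _           = refl
flipLast-below {suc k} g {suc p} (ℕ.s<s p<k) = flipLast-below (g ∘ suc) p<k

flipLast-last : ∀ {k} (g : Fin (suc k) → Bool) → flipLast g (fromℕ k) ≡ not (g (fromℕ k))
flipLast-last {ℕ.zero} g = refl
flipLast-last {suc k}  g = flipLast-last (g ∘ suc)

cascade-flipLast : ∀ {k} (t b : Fin (suc k) → Bool) → cascade t b ≡ cascade (flipLast t) (flipLast b)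
cascade-flipLast {ℕ.zero} t b with t zero
... | true  = sym (not-involutive (b zero))
... | false = refl
cascade-flipLast {suc k} t b with t zero
... | true  = refl
... | false = cascade-flipLast (t ∘ suc) (b ∘ suc)

-- The nested canalyzing function whose i-th layer tests variable i against a i;
-- by definition  ncf π a b x = canonical a b (x ∘ π).
canonical : ∀ {m} → (a b : Fin (suc m) → Bool) → BoolFn (suc m)
canonical a b y = cascade (λ p → does (y p Bool.≟ a p)) b

canonical-cong : ∀ {m} (a b : Fin (suc m) → Bool) {x y : Fin (suc m) → Bool}
               → (∀ i → x i ≡ y i) → canonical a b x ≡ canonical a b y
canonical-cong a b x≗y = cascade-cong b (λ p → cong (λ v → does (v Bool.≟ a p)) (x≗y p))

negated-fails : ∀ {u v} → u ≡ not v → does (u Bool.≟ v) ≡ false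
negated-fails {u} {v} u≡¬v = dec-false (u Bool.≟ v) (λ u≡v → not-¬ u≡v u≡¬v)

canonical-first : ∀ {m} (a b : Fin (suc m) → Bool) {y s} → (∀ p → p < s → y p ≡ not (a p)) → y s ≡ a s
                → canonical a b y ≡ b s
canonical-first a b {y} {s} earlier ys≡as =
  cascade-first _ b (λ p p<s → negated-fails (earlier p p<s)) (dec-true (y s Bool.≟ a s) ys≡as)

canonical-negated : ∀ {m} (a b : Fin (suc m) → Bool) → canonical a b (not ∘ a) ≡ not (b (fromℕ m))
canonical-negated a b = cascade-none _ b (λ p → negated-fails {v = a p} refl)

canonical-transpose : ∀ {m} (a b : Fin (suc m) → Bool) {q r} → q ≤ r → a q ≡ a r
                    → (∀ p → q ≤ p → p ≤ r → b p ≡ b q) → SymmetricVars (canonical a b) q r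
canonical-transpose a b q≤r aq≡ar b-const y =
  trans (cascade-transpose _ b q≤r b-const)
        (cascade-cong b (λ p → cong (λ v → does (y (PC.transpose _ _ p) Bool.≟ v)) (transpose-invariant a aq≡ar p)))

not-does-≟ : ∀ u v → not (does (u Bool.≟ v)) ≡ does (u Bool.≟ not v)
not-does-≟ false false = refl
not-does-≟ false true  = refl
not-does-≟ true  false = refl
not-does-≟ true  true  = refl

flipLast-tests : ∀ {k} (y a : Fin (suc k) → Bool) p
               → flipLast (λ i → does (y i Bool.≟ a i)) p ≡ does (y p Bool.≟ flipLast a p)
flipLast-tests {ℕ.zero} y a zero    = not-does-≟ (y zero) (a zero)
flipLast-tests {suc k}  y a zero    = refl
flipLast-tests {suc k}  y a (suc p) = flipLast-tests (y ∘ suc) (a ∘ suc) p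

canonical-flipLast : ∀ {m} (a b : Fin (suc m) → Bool) y
                   → canonical a b y ≡ canonical (flipLast a) (flipLast b) y
canonical-flipLast a b y = trans (cascade-flipLast _ b) (cascade-cong (flipLast b) (flipLast-tests y a))

-- A variable q and the last variable are symmetric when their canalyzing values
-- differ, the outputs from layer q to the last one are constant and the final
-- default output not (b last) agrees with them: after negating the last
-- canalyzing value and output this is an instance of canonical-transpose.
canonical-transpose-last : ∀ {m} (a b : Fin (suc m) → Bool) {q} → toℕ q ℕ.< m → a q ≢ a (fromℕ m)
                         → (∀ p → q ≤ p → toℕ p ℕ.< m → b p ≡ b q) → not (b (fromℕ m)) ≡ b q
                         → SymmetricVars (canonical a b) q (fromℕ m)
canonical-transpose-last {m} a b {q} q<m aq≢aL b-below b-default y = begin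
  canonical a b y                                   ≡⟨ canonical-flipLast a b y ⟩
  canonical (flipLast a) (flipLast b) y             ≡⟨ canonical-transpose (flipLast a) (flipLast b) q≤L a′q≡a′L b′-const y ⟩
  canonical (flipLast a) (flipLast b) (y ∘ swapped) ≡⟨ canonical-flipLast a b (y ∘ swapped) ⟨
  canonical a b (y ∘ swapped)                       ∎
  where
  open ≡-Reasoning
  swapped : Fin (suc m) → Fin (suc m)
  swapped = PC.transpose q (fromℕ m)

  q≤L : q ≤ fromℕ m
  q≤L = subst (toℕ q ℕ.≤_) (sym (toℕ-fromℕ m)) (ℕ.<⇒≤ q<m)

  a′q≡a′L : flipLast a q ≡ flipLast a (fromℕ m)
  a′q≡a′L = trans (flipLast-below a q<m) (trans (¬-not aq≢aL) (sym (flipLast-last a)))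

  b′-const : ∀ p → q ≤ p → p ≤ fromℕ m → flipLast b p ≡ flipLast b q
  b′-const p q≤p _ with below-or-last p
  ... | inj₁ p<m = trans (flipLast-below b p<m) (trans (b-below p q≤p p<m) (sym (flipLast-below b q<m)))
  ... | inj₂ refl = trans (flipLast-last b) (trans b-default (sym (flipLast-below b q<m)))

SymmetricPair : ∀ {n} → BoolFn n → Set
SymmetricPair {n} f = Σ (Fin n) λ u → Σ (Fin n) λ v → u ≢ v × SymmetricVars f u v

module Rigidity {m} (a b : Fin (suc m) → Bool) (τ : Permutation′ (suc m))
  (invariant : ∀ y → canonical a b y ≡ canonical a b (λ p → y (τ ⟨$⟩ʳ p)))
  (moves : ¬ (∀ p → τ ⟨$⟩ʳ p ≡ p)) where

  firstMoved : ∃ λ q → τ ⟨$⟩ʳ q ≢ q × ((j : Fin′ q) → τ ⟨$⟩ʳ inject j ≡ inject j)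
  firstMoved = ¬∀⟶∃¬-smallest (suc m) _ (λ p → τ ⟨$⟩ʳ p ≟ p) moves

  q r : Fin (suc m)
  q = proj₁ firstMoved
  r = τ ⟨$⟩ʳ q

  r≢q : r ≢ q
  r≢q = proj₁ (proj₂ firstMoved)

  fixed-below : ∀ p → p < q → τ ⟨$⟩ʳ p ≡ p
  fixed-below p p<q = subst (λ k → τ ⟨$⟩ʳ k ≡ k) inject-p (proj₂ (proj₂ firstMoved) (fromℕ< p<q))
    where
    inject-p : inject (fromℕ< p<q) ≡ p
    inject-p = toℕ-injective (trans (toℕ-inject (fromℕ< p<q)) (toℕ-fromℕ< p<q))

  -- r cannot lie below q, where τ is the identity.
  q<r : q < r
  q<r with <-cmp q r
  ... | tri< q<r _ _ = q<r
  ... | tri≈ _ q≡r _ = contradiction (sym q≡r) r≢q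
  ... | tri> _ _ r<q = contradiction (permutation-injective τ (fixed-below r r<q)) r≢q

  -- Probing: an input which is non-canalyzing before layer q and gives
  -- variable r the value a q evaluates to b q, because τ moves r into layer q.
  probe : ∀ y → y r ≡ a q → (∀ p → p < q → y p ≡ not (a p)) → canonical a b y ≡ b q
  probe y yr≡aq earlier = trans (invariant y)
    (canonical-first a b (λ p p<q → trans (cong y (fixed-below p p<q)) (earlier p p<q)) yr≡aq)

  set : (Fin (suc m) → Bool) → Fin (suc m) → Bool → Fin (suc m) → Bool
  set y i v = updateAt y i (const v)

  set-here : ∀ y i v → set y i v i ≡ v
  set-here y i v = updateAt-updates i y

  set-away : ∀ y {i j} v → i ≢ j → set y j v i ≡ y i
  set-away y {i} {j} v = updateAt-minimal i j y

  b-between : ∀ p → q < p → p < r → b p ≡ b q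
  b-between p q<p p<r = trans (sym (canonical-first a b earlier at-p)) (probe y (set-here _ r (a q)) before-q)
    where
    y : Fin (suc m) → Bool
    y = set (set (not ∘ a) p (a p)) r (a q)
    at-p : y p ≡ a p
    at-p = trans (set-away _ (a q) (<⇒≢ p<r)) (set-here (not ∘ a) p (a p))
    elsewhere : ∀ i → i ≢ r → i ≢ p → y i ≡ not (a i)
    elsewhere i i≢r i≢p = trans (set-away _ (a q) i≢r) (set-away (not ∘ a) (a p) i≢p)
    earlier : ∀ i → i < p → y i ≡ not (a i)
    earlier i i<p = elsewhere i (<⇒≢ (ℕ.<-trans i<p p<r)) (<⇒≢ i<p)
    before-q : ∀ i → i < q → y i ≡ not (a i)
    before-q i i<q = elsewhere i (<⇒≢ (ℕ.<-trans i<q q<r)) (<⇒≢ (ℕ.<-trans i<q q<p))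

  -- If a q ≡ a r, the probe canalyzed at r shows that layer r has output b q too.
  b-at-r : a q ≡ a r → b r ≡ b q
  b-at-r aq≡ar = trans (sym (canonical-first a b earlier (set-here (not ∘ a) r (a r))))
                       (probe y (trans (set-here (not ∘ a) r (a r)) (sym aq≡ar)) (λ i i<q → earlier i (ℕ.<-trans i<q q<r)))
    where
    y : Fin (suc m) → Bool
    y = set (not ∘ a) r (a r)
    earlier : ∀ i → i < r → y i ≡ not (a i)
    earlier i i<r = set-away (not ∘ a) (a r) (<⇒≢ i<r)

  b-from-q-to-r : a q ≡ a r → ∀ p → q ≤ p → p ≤ r → b p ≡ b q
  b-from-q-to-r aq≡ar p q≤p p≤r with p ≟ q | p ≟ r
  ... | yes p≡q | _       = cong b p≡q
  ... | no _    | yes p≡r = trans (cong b p≡r) (b-at-r aq≡ar)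
  ... | no p≢q  | no p≢r  = b-between p (≤∧≢⇒< q≤p (p≢q ∘ sym)) (≤∧≢⇒< p≤r p≢r)

  -- If a q ≢ a r, the input with no canalyzing variable is itself a probe.
  negated-probe : a q ≢ a r → canonical a b (not ∘ a) ≡ b q
  negated-probe aq≢ar = probe (not ∘ a) (sym (¬-not aq≢ar)) (λ _ _ → refl)

  -- ... and then r is the last variable: otherwise giving the last variable
  -- its canalyzing value yields a probe with output b last, whereas the
  -- negated input has output not (b last).
  r-last : a q ≢ a r → r ≡ fromℕ m
  r-last aq≢ar with below-or-last r
  ... | inj₂ r≡L = r≡L
  ... | inj₁ r<m = contradiction (trans bL≡bq (sym (trans (sym (canonical-negated a b)) (negated-probe aq≢ar))))
                                 (not-¬ refl)
    where
    y : Fin (suc m) → Bool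
    y = set (not ∘ a) (fromℕ m) (a (fromℕ m))
    bL≡bq : b (fromℕ m) ≡ b q
    bL≡bq = trans (sym (canonical-first a b (λ i i<L → set-away (not ∘ a) (a (fromℕ m)) (<⇒≢ i<L))
                                             (set-here (not ∘ a) (fromℕ m) (a (fromℕ m)))))
                  (probe y (trans (set-away (not ∘ a) (a (fromℕ m)) (below⇒≢last r<m)) (sym (¬-not aq≢ar)))
                         (λ i i<q → set-away (not ∘ a) (a (fromℕ m)) (below⇒≢last (ℕ.<-trans i<q (ℕ.<-trans q<r r<m)))))

  symmetricPair : SymmetricPair (canonical a b)
  symmetricPair with a q Bool.≟ a r
  ... | yes aq≡ar = q , r , r≢q ∘ sym , canonical-transpose a b (ℕ.<⇒≤ q<r) aq≡ar (b-from-q-to-r aq≡ar)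
  ... | no aq≢ar  = q , fromℕ m , below⇒≢last q<m , canonical-transpose-last a b q<m aq≢aL b-below b-default
    where
    r≡L : r ≡ fromℕ m
    r≡L = r-last aq≢ar
    toℕr≡m : toℕ r ≡ m
    toℕr≡m = trans (cong toℕ r≡L) (toℕ-fromℕ m)
    q<m : toℕ q ℕ.< m
    q<m = subst (toℕ q ℕ.<_) toℕr≡m q<r
    aq≢aL : a q ≢ a (fromℕ m)
    aq≢aL = subst (λ k → a q ≢ a k) r≡L aq≢ar
    b-below : ∀ p → q ≤ p → toℕ p ℕ.< m → b p ≡ b q
    b-below p q≤p p<m with p ≟ q
    ... | yes p≡q = cong b p≡q
    ... | no p≢q  = b-between p (≤∧≢⇒< q≤p (p≢q ∘ sym)) (subst (toℕ p ℕ.<_) (sym toℕr≡m) p<m)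
    b-default : not (b (fromℕ m)) ≡ b q
    b-default = trans (sym (canonical-negated a b)) (negated-probe aq≢ar)

Extensional : ∀ {n} → BoolFn n → Set
Extensional {n} f = ∀ {x y : Fin n → Bool} → (∀ i → x i ≡ y i) → f x ≡ f y

ncf-extensional : ∀ {m} {f : BoolFn (suc m)} → NestedCanalyzing f → Extensional f
ncf-extensional {f = f} (π , a , b , f≡ncf) {x} {y} x≗y =
  trans (f≡ncf x) (trans (canonical-cong a b (x≗y ∘ (π ⟨$⟩ʳ_))) (sym (f≡ncf y)))

symmetric-refl : ∀ {n} {f : BoolFn n} → Extensional f → ∀ i → SymmetricVars f i i
symmetric-refl ext i x = ext (λ k → cong x (sym (transpose-invariant (λ k → k) refl k)))

symmetric-sym : ∀ {n} {f : BoolFn n} → Extensional f → ∀ {i j} → SymmetricVars f i j → SymmetricVars f j i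
symmetric-sym {f = f} ext {i} {j} sym-ij x = begin
  f x                                                                      ≡⟨ ext (λ k → cong x (sym (PC.transpose-inverse j i))) ⟩
  f (λ k → x (PC.transpose j i (PC.transpose i j k)))                      ≡⟨ sym-ij _ ⟨
  f (λ k → x (PC.transpose j i k))                                         ∎
  where open ≡-Reasoning

discrete-symmetric : ∀ {n} {f : BoolFn n} → Extensional f → RSymmetric n f
discrete-symmetric ext = (λ i → i) , λ i j i≡j → subst (SymmetricVars _ i) i≡j (symmetric-refl ext i)

fewer-classes⇒pair : ∀ {m} {f : BoolFn (suc m)} → RSymmetric m f → SymmetricPair f
fewer-classes⇒pair {m} (class , same-class⇒sym) with pigeonhole (ℕ.n<1+n m) class
... | i , j , i<j , same = i , j , <⇒≢ i<j , same-class⇒sym i j same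

-- A labelling of Fin (suc m) by Fin m that identifies exactly u and v:
-- v receives the label of u, and all labels are computed by removing v.
module Merge {m} {u v : Fin (suc m)} (u≢v : u ≢ v) where
  labelBy : ∀ k → Dec (k ≡ v) → Fin m
  labelBy _ (yes _)  = punchOut (u≢v ∘ sym)
  labelBy k (no k≢v) = punchOut (k≢v ∘ sym)

  label : Fin (suc m) → Fin m
  label k = labelBy k (k ≟ v)

  label-identifies : ∀ k l → label k ≡ label l → k ≡ l ⊎ (k ≡ u × l ≡ v) ⊎ (k ≡ v × l ≡ u)
  label-identifies k l = by-cases (k ≟ v) (l ≟ v)
    where
    by-cases : (k? : Dec (k ≡ v)) (l? : Dec (l ≡ v)) → labelBy k k? ≡ labelBy l l?
             → k ≡ l ⊎ (k ≡ u × l ≡ v) ⊎ (k ≡ v × l ≡ u)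
    by-cases (yes k≡v) (yes l≡v) _ = inj₁ (trans k≡v (sym l≡v))
    by-cases (yes k≡v) (no l≢v)  e = inj₂ (inj₂ (k≡v , sym (punchOut-injective (u≢v ∘ sym) (l≢v ∘ sym) e)))
    by-cases (no k≢v)  (yes l≡v) e = inj₂ (inj₁ (punchOut-injective (k≢v ∘ sym) (u≢v ∘ sym) e , l≡v))
    by-cases (no k≢v)  (no l≢v)  e = inj₁ (punchOut-injective (k≢v ∘ sym) (l≢v ∘ sym) e)

pair⇒fewer-classes : ∀ {m} {f : BoolFn (suc m)} → Extensional f → SymmetricPair f → RSymmetric m f
pair⇒fewer-classes {f = f} ext (u , v , u≢v , sym-uv) = label , λ k l same → symmetric (label-identifies k l same)
  where
  open Merge u≢v
  symmetric : ∀ {k l} → k ≡ l ⊎ (k ≡ u × l ≡ v) ⊎ (k ≡ v × l ≡ u) → SymmetricVars f k l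
  symmetric (inj₁ refl)                 = symmetric-refl ext _
  symmetric (inj₂ (inj₁ (refl , refl))) = sym-uv
  symmetric (inj₂ (inj₂ (refl , refl))) = symmetric-sym ext sym-uv

-- A transposition is not the identity, so strong asymmetry forbids symmetric pairs.
asymmetric⇒no-pair : ∀ {n} {f : BoolFn n} → StronglyAsymmetric f → ¬ SymmetricPair f
asymmetric⇒no-pair asym (u , v , u≢v , sym-uv)
  with asym (transpose u v) (λ fixes → u≢v (trans (sym (fixes u)) (transpose-at-left u v)))
... | c , differs = differs (sym-uv c)

-- Invariance under a permutation is decidable, by enumerating all inputs.
decide-invariance : ∀ {n} {f : BoolFn n} → Extensional f → (σ : Permutation′ n)
                  → (∃ λ c → f c ≢ f (λ i → c (σ ⟨$⟩ʳ i))) ⊎ (∀ c → f c ≡ f (λ i → c (σ ⟨$⟩ʳ i)))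
decide-invariance {f = f} ext σ with anySubset? (λ s → ¬? (f (lookup s) Bool.≟ f (λ i → lookup s (σ ⟨$⟩ʳ i))))
... | yes (s , differs) = inj₁ (lookup s , differs)
... | no none = inj₂ λ c → begin
  f c                                        ≡⟨ ext (λ i → lookup∘tabulate c i) ⟨
  f (lookup (tabulate c))                    ≡⟨ decidable-stable (_ Bool.≟ _) (λ differs → none (tabulate c , differs)) ⟩
  f (λ i → lookup (tabulate c) (σ ⟨$⟩ʳ i))   ≡⟨ ext (λ i → lookup∘tabulate c (σ ⟨$⟩ʳ i)) ⟩
  f (λ i → c (σ ⟨$⟩ʳ i))                     ∎
  where open ≡-Reasoning

-- A nested canalyzing function invariant under some σ ≠ id has a symmetric
-- pair: conjugating by its variable order π turns σ into τ = π⁻¹σπ acting on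
-- the canonical NCF, and symmetric pairs of the latter map back along π.
ncf-rigid : ∀ {m} {f : BoolFn (suc m)} → NestedCanalyzing f → (σ : Permutation′ (suc m))
          → ¬ (∀ i → σ ⟨$⟩ʳ i ≡ i) → (∀ c → f c ≡ f (λ i → c (σ ⟨$⟩ʳ i))) → SymmetricPair f
ncf-rigid {m} {f} (π , a , b , f≡ncf) σ σ-moves f-invariant =
  transfer (Rigidity.symmetricPair a b τ τ-invariant τ-moves)
  where
  open ≡-Reasoning
  τ : Permutation′ (suc m)
  τ = π ∘ₚ σ ∘ₚ flip π

  τ-invariant : ∀ y → canonical a b y ≡ canonical a b (λ p → y (τ ⟨$⟩ʳ p))
  τ-invariant y = begin
    canonical a b y                           ≡⟨ canonical-cong a b (λ p → cong y (sym (inverseˡ π))) ⟩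
    canonical a b (λ p → x (π ⟨$⟩ʳ p))        ≡⟨ f≡ncf x ⟨
    f x                                       ≡⟨ f-invariant x ⟩
    f (λ i → x (σ ⟨$⟩ʳ i))                    ≡⟨ f≡ncf _ ⟩
    canonical a b (λ p → y (τ ⟨$⟩ʳ p))        ∎
    where
    x : Fin (suc m) → Bool
    x w = y (π ⟨$⟩ˡ w)

  τ-moves : ¬ (∀ p → τ ⟨$⟩ʳ p ≡ p)
  τ-moves τ-fixes = σ-moves λ k → begin
    σ ⟨$⟩ʳ k                                  ≡⟨ cong (σ ⟨$⟩ʳ_) (inverseʳ π) ⟨
    σ ⟨$⟩ʳ (π ⟨$⟩ʳ (π ⟨$⟩ˡ k))                 ≡⟨ inverseʳ π ⟨
    π ⟨$⟩ʳ (τ ⟨$⟩ʳ (π ⟨$⟩ˡ k))                 ≡⟨ cong (π ⟨$⟩ʳ_) (τ-fixes _) ⟩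
    π ⟨$⟩ʳ (π ⟨$⟩ˡ k)                          ≡⟨ inverseʳ π ⟩
    k                                         ∎

  transfer : SymmetricPair (canonical a b) → SymmetricPair f
  transfer (q , r , q≢r , sym-qr) = π ⟨$⟩ʳ q , π ⟨$⟩ʳ r , q≢r ∘ permutation-injective π , λ x → begin
    f x                                                                      ≡⟨ f≡ncf x ⟩
    canonical a b (λ p → x (π ⟨$⟩ʳ p))                                        ≡⟨ sym-qr (λ p → x (π ⟨$⟩ʳ p)) ⟩
    canonical a b (λ p → x (π ⟨$⟩ʳ PC.transpose q r p))                       ≡⟨ canonical-cong a b (λ p → cong x (transpose-conjugate π q r p)) ⟨
    canonical a b (λ p → x (PC.transpose (π ⟨$⟩ʳ q) (π ⟨$⟩ʳ r) (π ⟨$⟩ʳ p)))    ≡⟨ f≡ncf _ ⟨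
    f (λ k → x (PC.transpose (π ⟨$⟩ʳ q) (π ⟨$⟩ʳ r) k))                        ∎

no-pair⇒asymmetric : ∀ {m} {f : BoolFn (suc m)} → NestedCanalyzing f → ¬ SymmetricPair f → StronglyAsymmetric f
no-pair⇒asymmetric ncf no-pair σ σ-moves with decide-invariance (ncf-extensional ncf) σ
... | inj₁ witness   = witness
... | inj₂ invariant = contradiction (ncf-rigid ncf σ σ-moves invariant) no-pair

theorem5 : (m : ℕ) (f : BoolFn (suc m)) → NestedCanalyzing f →
    (StronglyAsymmetric f ⇔ ProperlyRSymmetric (suc m) f)
theorem5 m f ncf = mk⇔
  (λ asym → discrete-symmetric ext , λ fewer → asymmetric⇒no-pair asym (fewer-classes⇒pair fewer))
  (λ (_ , not-fewer) → no-pair⇒asymmetric ncf (not-fewer ∘ pair⇒fewer-classes ext))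
  where
  ext : Extensional f
  ext = ncf-extensional ncf
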